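{- Let $D$ be a finite digraph and $\alpha=(\alpha_v)_{v\in V(D)}$ a family of mutually disjoint finite digraphs. Suppose $D$ is kernel-perfect and, for each $u\in V(D)$, $f_u$ is a semi-Grundy function of $\alpha_u$, and let $m_u=\max\{f_u(x): x\in V(\alpha_u)\}$. Then $\sigma(D,\alpha)$ has a semi-Grundy function $S$ such that $\max\{S(x): x\in V(\sigma(D,\alpha))\}\le \sum_{u\in V(D)} m_u + |V(D)|-1$.
   Context: All digraphs are finite. For a vertex $x$ of a digraph $D$, $\Gamma^+(x)$ denotes the set of out-neighbours of $x$. A function $s:V(D)\to\mathbb{N}$ (with $\mathbb{N}=\{0,1,2,\dots\}$) is a semi-Grundy function of $D$ if (1) whenever $s(x)=k$, every $y\in\Gamma^+(x)$ satisfies $s(y)\neq k$; and (2) whenever $s(x)=k$, $y\in\Gamma^+(x)$ and $s(y)>k$, there exists $z\in\Gamma^+(y)$ with $s(z)=k$. Standing convention of the paper: every semi-Grundy function considered takes as its set of values a set of consecutive non-negative integers starting at $0$. A kernel of $D$ is an independent set $N$ such that every vertex not in $N$ has an arc to some vertex of $N$; $D$ is kernel-perfect if every induced subdigraph of $D$ has a kernel. Given $D$ and a family $\alpha=(\alpha_v)_{v\in V(D)}$ of mutually disjoint digraphs, the Cartesian product $\sigma(D,\alpha)$ has vertex set $\bigcup_{v}V(\alpha_v)$ and arc set $\bigcup_{v}A(\alpha_v)\cup\{(x,y): x\in V(\alpha_u),\ y\in V(\alpha_v),\ (u,v)\in A(D)\}$. -}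

module Defs where

open import Data.Nat using (ℕ; zero; suc; _+_; _≤_; _<_; _⊔_)
open import Data.Fin using (Fin; zero; suc)
open import Data.Bool using (Bool; true; false)
open import Data.Product using (Σ; ∃; _×_; _,_; proj₁; proj₂)
open import Relation.Binary.PropositionalEquality using (_≡_)
open import Relation.Nullary using (¬_)

record Digraph : Set where
  field
    pred     : ℕ
    arc      : Fin (suc pred) → Fin (suc pred) → Bool
    loopless : ∀ x → arc x x ≡ false

open Digraph public

order : Digraph → ℕ
order D = suc (pred D)

V : Digraph → Set
V D = Fin (order D)

Arc : (D : Digraph) → V D → V D → Set
Arc D x y = arc D x y ≡ true

-- Semi-Grundy function for an arbitrary digraph given by a vertex type and
-- an arc relation, with the standing convention that the set of values is
-- {0, 1, ..., max} (every value below an attained value is attained).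
record IsSemiGrundy {W : Set} (A : W → W → Set) (s : W → ℕ) : Set where
  field
    independent : ∀ x y → A x y → ¬ (s y ≡ s x)
    absorbing   : ∀ x y → A x y → s x < s y → ∃ λ z → A y z × s z ≡ s x
    consecutive : ∀ x k → k ≤ s x → ∃ λ y → s y ≡ k

-- Kernel of the subdigraph of D induced by the vertex subset S.
record IsKernelOf (D : Digraph) (S N : V D → Bool) : Set where
  field
    inside      : ∀ x → N x ≡ true → S x ≡ true
    independent : ∀ x y → N x ≡ true → N y ≡ true → ¬ Arc D x y
    absorbing   : ∀ x → S x ≡ true → N x ≡ false →
                  ∃ λ y → N y ≡ true × Arc D x y

KernelPerfect : Digraph → Set
KernelPerfect D = ∀ (S : V D → Bool) → ∃ λ (N : V D → Bool) → IsKernelOf D S N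

maxFin : ∀ {k} → (Fin (suc k) → ℕ) → ℕ
maxFin {zero}  f = f zero
maxFin {suc k} f = f zero ⊔ maxFin {k} (λ i → f (suc i))

sumFin : ∀ {k} → (Fin k → ℕ) → ℕ
sumFin {zero}  f = 0
sumFin {suc k} f = f zero + sumFin (λ i → f (suc i))

σV : (D : Digraph) → (V D → Digraph) → Set
σV D α = Σ (V D) (λ u → V (α u))

data σArc (D : Digraph) (α : V D → Digraph) : σV D α → σV D α → Set where
  inner : ∀ {u x y} → Arc (α u) x y → σArc D α (u , x) (u , y)
  outer : ∀ {u v x y} → Arc D u v → σArc D α (u , x) (v , y)

-- Give every vertex u of D a quota m u = max f u and a counter, the
-- level of u, starting at 0.  In round t call u active when its level is
-- still ≤ m u, choose a kernel N t of the subdigraph induced by the active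
-- vertices (D is kernel-perfect), and raise the level of every vertex of
-- N t by one.  A vertex u is then in the kernel exactly once at each level
-- j ≤ m u, and S(u, x) is defined as the round t in which u is in N t at
-- level f u x.  Inside a fibre α u, S is a strictly monotone relabelling of
-- f u; between fibres, independence and absorption of the kernels N t give
-- the semi-Grundy conditions.  The potential Σ (m u + 1 − level u) drops in
-- every round with an active vertex, which bounds every round number by
-- Σ m u + |V(D)| − 1.
module Submission where

open import Defs
open import Data.Nat using (ℕ; _+_; _∸_; _≤_)
open import Data.Product using (Σ; ∃; _×_; _,_)

open import Data.Nat using (zero; suc; _<_; _≤ᵇ_; z≤n; s≤s; _<?_; s≤s⁻¹)
open import Data.Nat.Properties
open import Data.Fin using (Fin; zero; suc)
open import Data.Bool using (Bool; true; false)
open import Data.Bool.Properties using (T-≡)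
open import Data.Sum using (inj₁; inj₂)
open import Data.Empty using (⊥-elim)
open import Data.Product using (proj₁; proj₂)
open import Function.Bundles using (Equivalence)
open import Relation.Binary.Definitions using (tri<; tri≈; tri>)
open import Relation.Binary.PropositionalEquality
  using (_≡_; refl; sym; trans; cong; subst; subst₂; module ≡-Reasoning)
open import Relation.Nullary using (¬_; yes; no)

maxFin-upper : ∀ {k} (g : Fin (suc k) → ℕ) i → g i ≤ maxFin g
maxFin-upper {zero}  g zero    = ≤-refl
maxFin-upper {suc k} g zero    = m≤m⊔n (g zero) _
maxFin-upper {suc k} g (suc i) =
  ≤-trans (maxFin-upper (λ j → g (suc j)) i) (m≤n⊔m (g zero) _)

maxFin-attained : ∀ {k} (g : Fin (suc k) → ℕ) → ∃ λ i → g i ≡ maxFin g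
maxFin-attained {zero}  g = zero , refl
maxFin-attained {suc k} g with ⊔-sel (g zero) (maxFin (λ j → g (suc j)))
... | inj₁ e = zero , sym e
... | inj₂ e with maxFin-attained (λ j → g (suc j))
...   | i , p = suc i , trans p (sym e)

sumFin-suc : ∀ {k} (g : Fin k → ℕ) → sumFin (λ i → suc (g i)) ≡ sumFin g + k
sumFin-suc {zero}  g = refl
sumFin-suc {suc k} g = begin
  suc (g zero + sumFin (λ i → suc (g (suc i))))
    ≡⟨ cong (λ s → suc (g zero + s)) (sumFin-suc (λ i → g (suc i))) ⟩
  suc (g zero + (sumFin (λ i → g (suc i)) + k))
    ≡⟨ cong suc (sym (+-assoc (g zero) _ k)) ⟩
  suc (sumFin g + k)
    ≡⟨ sym (+-suc (sumFin g) k) ⟩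
  sumFin g + suc k ∎
  where open ≡-Reasoning

sumFin-term : ∀ {k} (g : Fin k → ℕ) i → g i ≤ sumFin g
sumFin-term g zero    = m≤m+n _ _
sumFin-term g (suc i) = ≤-trans (sumFin-term (λ j → g (suc j)) i) (m≤n+m _ (g zero))

sumFin-mono : ∀ {k} (g h : Fin k → ℕ) → (∀ i → g i ≤ h i) → sumFin g ≤ sumFin h
sumFin-mono {zero}  g h le = z≤n
sumFin-mono {suc k} g h le =
  +-mono-≤ (le zero) (sumFin-mono (λ i → g (suc i)) (λ i → h (suc i)) (λ i → le (suc i)))

sumFin-strict : ∀ {k} (g h : Fin k → ℕ) → (∀ i → g i ≤ h i) →
                ∀ j → g j < h j → sumFin g < sumFin h
sumFin-strict g h le zero lt =
  +-mono-<-≤ lt (sumFin-mono (λ i → g (suc i)) (λ i → h (suc i)) (λ i → le (suc i)))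
sumFin-strict g h le (suc j) lt =
  +-mono-≤-< (le zero)
    (sumFin-strict (λ i → g (suc i)) (λ i → h (suc i)) (λ i → le (suc i)) j lt)

unit-step-crossing : (g : ℕ → ℕ) → (∀ t → g (suc t) ≤ suc (g t)) →
  ∀ j → g 0 ≤ j → ∀ T → j < g T → ∃ λ t → g t ≡ j × g (suc t) ≡ suc j
unit-step-crossing g step j start zero    above = ⊥-elim (<⇒≱ above start)
unit-step-crossing g step j start (suc T) above with j <? g T
... | yes earlier = unit-step-crossing g step j start T earlier
... | no ¬earlier = T , at-j , subst (λ a → g (suc T) ≡ suc a) at-j rises
  where
  at-j : g T ≡ j
  at-j = ≤-antisym (≮⇒≥ ¬earlier) (s≤s⁻¹ (≤-trans above (step T)))
  rises : g (suc T) ≡ suc (g T)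
  rises = ≤-antisym (step T) (subst (_< g (suc T)) (sym at-j) above)

semiGrundy-onto : (A : Digraph) {s : V A → ℕ} → IsSemiGrundy (Arc A) s →
                  ∀ c → c ≤ maxFin s → ∃ λ x → s x ≡ c
semiGrundy-onto A {s} sg c c≤max with maxFin-attained s
... | i , si≡max = IsSemiGrundy.consecutive sg i c (subst (c ≤_) (sym si≡max) c≤max)

module KernelSchedule (D : Digraph) (K : KernelPerfect D) (m : V D → ℕ) where

  active : (V D → ℕ) → V D → Bool
  active level w = level w ≤ᵇ m w

  active⇒≤ : ∀ level w → active level w ≡ true → level w ≤ m w
  active⇒≤ level w e = ≤ᵇ⇒≤ (level w) (m w) (Equivalence.from T-≡ e)

  ≤⇒active : ∀ level w → level w ≤ m w → active level w ≡ true
  ≤⇒active level w p = Equivalence.to T-≡ (≤⇒≤ᵇ p)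

  kernelFor : (V D → ℕ) → V D → Bool
  kernelFor level = proj₁ (K (active level))

  tick : Bool → ℕ → ℕ
  tick true  n = suc n
  tick false n = n

  -- level t w: how many of the rounds 0, …, t − 1 vertex w took part in.
  level : ℕ → V D → ℕ
  level zero    w = 0
  level (suc t) w = tick (kernelFor (level t) w) (level t w)

  kernel : ℕ → V D → Bool
  kernel t = kernelFor (level t)

  kernel-isKernel : ∀ t → IsKernelOf D (active (level t)) (kernel t)
  kernel-isKernel t = proj₂ (K (active (level t)))

  module Kernel (t : ℕ) = IsKernelOf (kernel-isKernel t)

  level-step : ∀ t w → level t w ≤ level (suc t) w
  level-step t w with kernel t w
  ... | true  = n≤1+n _
  ... | false = ≤-refl

  level-step-≤1 : ∀ t w → level (suc t) w ≤ suc (level t w)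
  level-step-≤1 t w with kernel t w
  ... | true  = ≤-refl
  ... | false = n≤1+n _

  level-in-kernel : ∀ t w → kernel t w ≡ true → level (suc t) w ≡ suc (level t w)
  level-in-kernel t w e rewrite e = refl

  level-mono : ∀ w {t t′} → t ≤ t′ → level t w ≤ level t′ w
  level-mono w {t} {zero} z≤n = ≤-refl
  level-mono w {t} {suc t′} t≤ with m≤n⇒m<n∨m≡n t≤
  ... | inj₁ t<  = ≤-trans (level-mono w (s≤s⁻¹ t<)) (level-step t′ w)
  ... | inj₂ refl = ≤-refl

  level-strict : ∀ w {t t′} → kernel t w ≡ true → t < t′ → level t w < level t′ w
  level-strict w {t} e t< =
    subst (_≤ _) (level-in-kernel t w e) (level-mono w t<)

  kernel-time-unique : ∀ w {t t′} → kernel t w ≡ true → kernel t′ w ≡ true →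
                       level t w ≡ level t′ w → t ≡ t′
  kernel-time-unique w {t} {t′} e e′ same with <-cmp t t′
  ... | tri< t< _ _ = ⊥-elim (<-irrefl same (level-strict w e t<))
  ... | tri≈ _ eq _ = eq
  ... | tri> _ _ t> = ⊥-elim (<-irrefl (sym same) (level-strict w e′ t>))

  kernel-nonempty : ∀ t w → active (level t) w ≡ true → ∃ λ v → kernel t v ≡ true
  kernel-nonempty t w act with kernel t w in eq
  ... | true  = w , eq
  ... | false with Kernel.absorbing t w act eq
  ...   | v , v∈N , _ = v , v∈N

  kernel-reaches : ∀ t u v → kernel t u ≡ true → Arc D u v →
                   active (level t) v ≡ true → ∃ λ w → kernel t w ≡ true × Arc D v w
  kernel-reaches t u v u∈N uv act with kernel t v in eq
  ... | true  = ⊥-elim (Kernel.independent t u v u∈N eq uv)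
  ... | false = Kernel.absorbing t v act eq

  potential : ℕ → ℕ
  potential t = sumFin (λ u → suc (m u) ∸ level t u)

  remaining-suc : ∀ t w → active (level t) w ≡ true →
                  suc (m w) ∸ level t w ≡ suc (m w ∸ level t w)
  remaining-suc t w act = +-∸-assoc 1 (active⇒≤ (level t) w act)

  potential-decreases : ∀ t w → kernel t w ≡ true → potential (suc t) < potential t
  potential-decreases t w w∈N =
    sumFin-strict _ _ (λ u → ∸-monoʳ-≤ (suc (m u)) (level-step t u)) w drop
    where
    drop : suc (m w) ∸ level (suc t) w < suc (m w) ∸ level t w
    drop = subst₂ _<_ (cong (suc (m w) ∸_) (sym (level-in-kernel t w w∈N)))
                      (sym (remaining-suc t w (Kernel.inside t w w∈N)))
                      (n<1+n _)

  potential-positive : ∀ t w → active (level t) w ≡ true → 1 ≤ potential t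
  potential-positive t w act =
    ≤-trans (subst (1 ≤_) (sym (remaining-suc t w act)) (s≤s z≤n))
            (sumFin-term (λ u → suc (m u) ∸ level t u) w)

  -- While some vertex stays active, every round consumes potential.
  potential-budget : ∀ t w → active (level t) w ≡ true → potential t + t ≤ potential 0
  potential-budget zero w act = ≤-reflexive (+-identityʳ _)
  potential-budget (suc t) w act = begin
    potential (suc t) + suc t ≡⟨ +-suc (potential (suc t)) t ⟩
    suc (potential (suc t)) + t ≤⟨ +-monoˡ-≤ t (potential-decreases t v v∈N) ⟩
    potential t + t             ≤⟨ potential-budget t w act-before ⟩
    potential 0                 ∎
    where
    open ≤-Reasoning
    act-before : active (level t) w ≡ true
    act-before = ≤⇒active (level t) w
                   (≤-trans (level-step t w) (active⇒≤ (level (suc t)) w act))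
    v = proj₁ (kernel-nonempty t w act-before)
    v∈N = proj₂ (kernel-nonempty t w act-before)

  active-round-bound : ∀ t w → active (level t) w ≡ true → suc t ≤ potential 0
  active-round-bound t w act =
    ≤-trans (+-monoˡ-≤ t (potential-positive t w act)) (potential-budget t w act)

  exhausted : ∀ u → m u < level (potential 0) u
  exhausted u with level (potential 0) u ≤? m u
  ... | no  over = ≰⇒> over
  ... | yes within = ⊥-elim (<-irrefl refl
          (active-round-bound (potential 0) u (≤⇒active (level (potential 0)) u within)))

  visit : ∀ u j → j ≤ m u → ∃ λ t → kernel t u ≡ true × level t u ≡ j
  visit u j j≤m
    with unit-step-crossing (λ t → level t u) (λ t → level-step-≤1 t u) j z≤n
           (potential 0) (≤-<-trans j≤m (exhausted u))
  ... | t , at-j , next with kernel t u in eq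
  ...   | true  = t , eq , at-j
  ...   | false = ⊥-elim (<-irrefl (trans (sym at-j) next) (n<1+n j))

module ProductGrundy (D : Digraph) (α : V D → Digraph) (K : KernelPerfect D)
  (f : (u : V D) → V (α u) → ℕ) (sg : ∀ u → IsSemiGrundy (Arc (α u)) (f u)) where

  open KernelSchedule D K (λ u → maxFin (f u))

  round : ∀ u x → ∃ λ t → kernel t u ≡ true × level t u ≡ f u x
  round u x = visit u (f u x) (maxFin-upper (f u) x)

  -- Kept abstract: only the two properties below are used, and unfolding the
  -- schedule during type checking is prohibitively expensive.
  abstract
    S : σV D α → ℕ
    S (u , x) = proj₁ (round u x)

    S-kernel : ∀ u x → kernel (S (u , x)) u ≡ true
    S-kernel u x = proj₁ (proj₂ (round u x))

    S-level : ∀ u x → level (S (u , x)) u ≡ f u x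
    S-level u x = proj₂ (proj₂ (round u x))

  S-unique : ∀ t u x → kernel t u ≡ true → level t u ≡ f u x → S (u , x) ≡ t
  S-unique t u x e same = kernel-time-unique u (S-kernel u x) e (trans (S-level u x) (sym same))

  S-covers : ∀ t w → kernel t w ≡ true → ∃ λ z → S (w , z) ≡ t
  S-covers t w e
    with semiGrundy-onto (α w) (sg w) (level t w) (active⇒≤ (level t) w (Kernel.inside t w e))
  ... | z , fz = z , S-unique t w z e (sym fz)

  active-before : ∀ u x t → t ≤ S (u , x) → active (level t) u ≡ true
  active-before u x t t≤ = ≤⇒active (level t) u
    (≤-trans (level-mono u t≤) (subst (_≤ maxFin (f u)) (sym (S-level u x)) (maxFin-upper (f u) x)))

  independent : ∀ p q → σArc D α p q → ¬ (S q ≡ S p)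
  independent (u , x) (.u , y) (inner xy) same = IsSemiGrundy.independent (sg u) x y xy
    (trans (sym (S-level u y)) (trans (cong (λ t → level t u) same) (S-level u x)))
  independent (u , x) (v , y) (outer uv) same =
    Kernel.independent (S (u , x)) u v (S-kernel u x)
      (subst (λ t → kernel t v ≡ true) same (S-kernel v y)) uv

  absorbing : ∀ p q → σArc D α p q → S p < S q → ∃ λ r → σArc D α q r × S r ≡ S p
  absorbing (u , x) (.u , y) (inner xy) lt
    with IsSemiGrundy.absorbing (sg u) x y xy
           (subst₂ _<_ (S-level u x) (S-level u y) (level-strict u (S-kernel u x) lt))
  ... | z , yz , fz≡fx =
    (u , z) , inner yz , S-unique (S (u , x)) u z (S-kernel u x) (trans (S-level u x) (sym fz≡fx))
  absorbing (u , x) (v , y) (outer uv) lt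
    with kernel-reaches (S (u , x)) u v (S-kernel u x) uv (active-before v y (S (u , x)) (<⇒≤ lt))
  ... | w , w∈N , vw with S-covers (S (u , x)) w w∈N
  ...   | z , Sz = (w , z) , outer vw , Sz

  consecutive : ∀ p k → k ≤ S p → ∃ λ q → S q ≡ k
  consecutive (u , x) k k≤ with kernel-nonempty k u (active-before u x k k≤)
  ... | w , w∈N with S-covers k w w∈N
  ...   | z , Sz = (w , z) , Sz

  isSemiGrundy : IsSemiGrundy (σArc D α) S
  isSemiGrundy = record
    { independent = independent ; absorbing = absorbing ; consecutive = consecutive }

  -- Σ (max f u + 1) = Σ max f u + |V(D)| bounds every round number plus one.
  bounded : ∀ p → S p ≤ sumFin (λ u → maxFin (f u)) + order D ∸ 1
  bounded (u , x) = subst (λ n → S (u , x) ≤ n ∸ 1) (sumFin-suc (λ u → maxFin (f u)))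
    (subst (S (u , x) ≤_) (pred[m∸n]≡m∸[1+n] (potential 0) 0)
      (suc[m]≤n⇒m≤pred[n]
        (active-round-bound (S (u , x)) u (Kernel.inside (S (u , x)) u (S-kernel u x)))))

corollary1 : (D : Digraph) (α : V D → Digraph) →
    KernelPerfect D →
    (f : (u : V D) → V (α u) → ℕ) →
    (∀ u → IsSemiGrundy (Arc (α u)) (f u)) →
    ∃ λ (S : σV D α → ℕ) →
    IsSemiGrundy (σArc D α) S ×
    (∀ x → S x ≤ sumFin (λ u → maxFin (f u)) + order D ∸ 1)
corollary1 D α K f sg = S , isSemiGrundy , bounded
  where open ProductGrundy D α K f sg
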